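{- For every $n \ge 1$, with $G_n$ as in the context, \[ b(G_n,\mathbb{Q}) + 1 = \frac{3^n - 1}{2} + 2 \cdot \frac{9^n - 3^n}{6} + 3^n + 3^n \cdot \frac{3^n - 1}{2} + 3^n \cdot \frac{9^n - 3^n}{6} \cdot \frac{1}{3}. \]
   Context: Let $A_n = \mathbb{Z}/3\mathbb{Z} \oplus (\mathbb{Z}/9\mathbb{Z})^n$, $\pi_0: A_n \to \mathbb{Z}/3\mathbb{Z}$ the projection onto the first summand, and for $1 \le i \le n$, $\pi_i: A_n \to \mathbb{Z}/3\mathbb{Z}$ the projection onto the $i$-th $\mathbb{Z}/9\mathbb{Z}$ followed by reduction mod $3$. Let $\theta = (\theta_1,\dots,\theta_n)$ with $\theta_i(a,b) = \pi_0(a)\pi_i(b)$, and let $G_n$ be $(\mathbb{Z}/3\mathbb{Z})^n \times A_n$ with group law $(c_1,a_1)(c_2,a_2) = (c_1+c_2+\theta(a_1,a_2), a_1+a_2)$. For a finite group $G$, define $g \sim h$ on $G - \{\mathrm{id}\}$ if the conjugacy class of $h$ equals that of $g^a$ for some integer $a$ coprime to $\mathrm{ord}(g)$, and let $b(G,\mathbb{Q}) := -1 + (\text{number of equivalence classes of } G - \{\mathrm{id}\} \text{ under } \sim)$. -}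

module Defs where

open import Data.Nat using (ℕ; zero; suc; _+_; _*_; _∸_; _^_; _≤_; _<_; NonZero)
open import Data.Nat.DivMod using (_mod_; _/_)
open import Data.Nat.Coprimality using (Coprime)
open import Data.Fin using (Fin; toℕ)
open import Data.Vec using (Vec; zipWith; map; replicate)
open import Data.Integer using (ℤ; +_; -[1+_]; ∣_∣)
open import Data.Product using (Σ; _×_)
open import Relation.Binary.PropositionalEquality using (_≡_; _≢_)

addMod : (k : ℕ) .{{_ : NonZero k}} → Fin k → Fin k → Fin k
addMod k x y = (toℕ x + toℕ y) mod k

negMod : (k : ℕ) .{{_ : NonZero k}} → Fin k → Fin k
negMod k x = (k ∸ toℕ x) mod k

red : Fin 9 → Fin 3
red x = toℕ x mod 3

mul3 : Fin 3 → Fin 3 → Fin 3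
mul3 x y = (toℕ x * toℕ y) mod 3

record A (n : ℕ) : Set where
  constructor mkA
  field
    a₀ : Fin 3
    b  : Vec (Fin 9) n
open A public

A+ : ∀ {n} → A n → A n → A n
A+ (mkA x u) (mkA y v) = mkA (addMod 3 x y) (zipWith (addMod 9) u v)

A- : ∀ {n} → A n → A n
A- (mkA x u) = mkA (negMod 3 x) (map (negMod 9) u)

A0 : ∀ {n} → A n
A0 {n} = mkA (0 mod 3) (replicate n (0 mod 9))

θ : ∀ {n} → A n → A n → Vec (Fin 3) n
θ (mkA x _) (mkA _ v) = map (λ vi → mul3 x (red vi)) v

record G (n : ℕ) : Set where
  constructor mkG
  field
    c : Vec (Fin 3) n
    a : A n
open G public

C+ : ∀ {n} → Vec (Fin 3) n → Vec (Fin 3) n → Vec (Fin 3) n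
C+ = zipWith (addMod 3)

C- : ∀ {n} → Vec (Fin 3) n → Vec (Fin 3) n
C- = map (negMod 3)

_·_ : ∀ {n} → G n → G n → G n
mkG c₁ a₁ · mkG c₂ a₂ = mkG (C+ (C+ c₁ c₂) (θ a₁ a₂)) (A+ a₁ a₂)

e : ∀ {n} → G n
e {n} = mkG (replicate n (0 mod 3)) A0

inv : ∀ {n} → G n → G n
inv (mkG c₁ a₁) = mkG (C+ (C- c₁) (C- (θ a₁ (A- a₁)))) (A- a₁)

pow : ∀ {n} → G n → ℕ → G n
pow g zero    = e
pow g (suc m) = g · pow g m

zpow : ∀ {n} → G n → ℤ → G n
zpow g (+ m)     = pow g m
zpow g -[1+ m ]  = pow (inv g) (suc m)

IsOrder : ∀ {n} → G n → ℕ → Set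
IsOrder g k = (1 ≤ k) × (pow g k ≡ e) × (∀ m → 1 ≤ m → m < k → pow g m ≢ e)

Conj : ∀ {n} → G n → G n → Set
Conj {n} y h = Σ (G n) λ x → h ≡ (x · y) · inv x

_∼_ : ∀ {n} → G n → G n → Set
_∼_ g h = Σ ℕ λ k → IsOrder g k × Σ ℤ λ a → Coprime ∣ a ∣ k × Conj (zpow g a) h

-- The number of equivalence classes of G_n − {id} under ∼ is N:
-- a system of N representatives (one per class).
NumClasses : ℕ → ℕ → Set
NumClasses n N =
  Σ (Fin N → G n) λ r →
    (∀ i → r i ≢ e) ×
    (∀ i j → r i ∼ r j → i ≡ j) ×
    (∀ g → g ≢ e → Σ (Fin N) λ i → r i ∼ g)

-- b(G_n, ℚ) + 1 is the number of classes; the claimed value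
-- (all divisions below are exact for n ≥ 1)
rhs : ℕ → ℕ
rhs n = (3 ^ n ∸ 1) / 2 + 2 * ((9 ^ n ∸ 3 ^ n) / 6) + 3 ^ n
      + 3 ^ n * ((3 ^ n ∸ 1) / 2) + (3 ^ n * ((9 ^ n ∸ 3 ^ n) / 6)) / 3

-- Write g ∈ G n as its ℤ/3ℤ-component x together with n coordinates (cᵢ, vᵢ) ∈ ℤ/3ℤ × ℤ/9ℤ.
-- Products, powers and conjugates are computed coordinatewise with x as a shared parameter;
-- conjugating by an element with components z and (c′ᵢ, v′ᵢ) fixes x and every vᵢ and shifts cᵢ by
-- z·π(vᵢ) − x·π(v′ᵢ). Every non-identity element has order 3 or 9, so g ∼ h says exactly that h is
-- conjugate to gᵘ for a unit u of ℤ/9ℤ. The classes therefore fall into three families: x = 0 with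
-- every vᵢ ∈ ker π, where conjugation is trivial and u acts as ±1; x = 0 with some vᵢ ∉ ker π; and
-- x ≠ 0, where u can be chosen to make x = 1 and conjugation clears every cᵢ. In each family a class
-- has exactly one echelon representative: the coordinates before the pivot lie in a small set on
-- which the remaining freedom acts trivially, normalising the pivot uses up the freedom in u and z,
-- and the coordinates after it are then determined. Counting echelon vectors gives geometric sums
-- whose closed forms add up to the formula.
module Submission where

open import Defs
open import Data.Empty using (⊥; ⊥-elim)
open import Data.Fin using (Fin; zero; suc; #_; toℕ; fromℕ<; opposite; _↑ˡ_; _↑ʳ_; splitAt; combine; remQuot)
open import Data.Fin.Properties using (all?; any?; _≟_; toℕ-fromℕ<; 0≢1+n; splitAt-↑ˡ; splitAt-↑ʳ; splitAt⁻¹-↑ˡ; splitAt⁻¹-↑ʳ; remQuot-combine; combine-remQuot)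
open import Data.Integer using (+_; -[1+_]; ∣_∣)
open import Data.Nat using (ℕ; zero; suc; _+_; _*_; _∸_; _^_; _%_; _/_; _≤_; _<_; s≤s; z≤n; NonZero)
open import Data.Nat.Coprimality using (Coprime; coprime?)
open import Data.Nat.Divisibility using (_∣_; _∣?_; divides; ∣n∣m%n⇒∣m)
open import Data.Nat.DivMod using (_mod_; m≡m%n+[m/n]*n; m%n<n; m*n/n≡m)
open import Data.Nat.GeneralisedArithmetic using (fold; fold-+)
open import Data.Nat.Properties using (<-cmp; +-identityʳ; *-identityˡ; m+n∸n≡m; +-cancelʳ-≡; *-cancelʳ-≡; ^-zeroˡ) renaming (_≟_ to _≟ℕ_)
open import Data.Nat.Tactic.RingSolver using (solve-∀)
open import Data.Product using (Σ; _×_; _,_; proj₁; proj₂; uncurry)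
open import Data.Product.Properties using () renaming (≡-dec to ×-≡-dec)
open import Data.Sum using (_⊎_; inj₁; inj₂; [_,_]′)
open import Data.Unit using (⊤; tt)
open import Data.Vec using (Vec; []; _∷_; head; tail; lookup; map; zipWith; zip; replicate; allFin; allPairs)
open import Data.Vec.Membership.Propositional using (_∈_)
open import Data.Vec.Membership.Propositional.Properties using (∈-lookup)
open import Data.Vec.Properties using (map-const; map-cong; map-∘; zipWith-map₂) renaming (≡-dec to Vec-≡-dec)
open import Data.Vec.Relation.Binary.Pointwise.Inductive using (Pointwise; []; _∷_)
open import Data.Vec.Relation.Unary.All as All using (All; []; _∷_)
open import Data.Vec.Relation.Unary.All.Properties using (map⁺; map⁻)
open import Data.Vec.Relation.Unary.Any using (here; index)
open import Data.Vec.Relation.Unary.Any.Properties using (lookup-index)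
open import Function using (_∘_; Injective)
open import Relation.Binary.Definitions using (DecidableEquality; tri<; tri≈; tri>)
open import Relation.Binary.PropositionalEquality
open import Relation.Nullary using (¬_; Dec; yes; no)
open import Relation.Nullary.Decidable using (True; toWitness; from-yes; map′; _×-dec_; _→-dec_; ¬?)
open import Relation.Unary using (Decidable)

-- Finite enumerations

record Enumeration {X : Set} (P : X → Set) (k : ℕ) : Set where
  field
    elem           : Fin k → X
    elem-sat       : ∀ i → P (elem i)
    elem-injective : Injective _≡_ _≡_ elem
    index-of       : ∀ x → P x → Σ (Fin k) λ i → elem i ≡ x
open Enumeration public

enumeration-⇔ : ∀ {X : Set} {P Q : X → Set} {k} → (∀ {x} → P x → Q x) → (∀ {x} → Q x → P x) →
                Enumeration P k → Enumeration Q k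
enumeration-⇔ to from E = record
  { elem = elem E ; elem-sat = to ∘ elem-sat E ; elem-injective = elem-injective E
  ; index-of = λ x → index-of E x ∘ from }

table-enumeration : ∀ {X : Set} {k} (t : Vec X k) → Injective _≡_ _≡_ (lookup t) → Enumeration (_∈ t) k
table-enumeration t lookup-injective = record
  { elem = lookup t ; elem-sat = λ i → ∈-lookup i t ; elem-injective = lookup-injective
  ; index-of = λ x x∈t → index x∈t , sym (lookup-index x∈t) }

Image : {X Y : Set} → (X → Y) → (X → Set) → Y → Set
Image {X} f P y = Σ X λ x → P x × f x ≡ y

image-enumeration : ∀ {X Y : Set} {P : X → Set} {k} (f : X → Y) → Injective _≡_ _≡_ f →
                    Enumeration P k → Enumeration (Image f P) k
image-enumeration f f-injective E = record
  { elem = f ∘ elem E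
  ; elem-sat = λ i → elem E i , elem-sat E i , refl
  ; elem-injective = elem-injective E ∘ f-injective
  ; index-of = λ { _ (x , px , refl) → let i , eq = index-of E x px in i , cong f eq } }

module _ {X : Set} {P Q : X → Set} {k m : ℕ} (E : Enumeration P k) (F : Enumeration Q m)
         (disjoint : ∀ {x} → P x → Q x → ⊥) where

  private
    elem⊎ : Fin (k + m) → X
    elem⊎ i = [ elem E , elem F ]′ (splitAt k i)

    elem⊎-sat : ∀ i → P (elem⊎ i) ⊎ Q (elem⊎ i)
    elem⊎-sat i with splitAt k i
    ... | inj₁ i₁ = inj₁ (elem-sat E i₁)
    ... | inj₂ i₂ = inj₂ (elem-sat F i₂)

    elem⊎-injective : Injective _≡_ _≡_ elem⊎
    elem⊎-injective {i} {j} eq with splitAt k i in ei | splitAt k j in ej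
    ... | inj₁ i₁ | inj₁ j₁ =
      trans (sym (splitAt⁻¹-↑ˡ ei)) (trans (cong (_↑ˡ m) (elem-injective E eq)) (splitAt⁻¹-↑ˡ ej))
    ... | inj₂ i₂ | inj₂ j₂ =
      trans (sym (splitAt⁻¹-↑ʳ ei)) (trans (cong (k ↑ʳ_) (elem-injective F eq)) (splitAt⁻¹-↑ʳ ej))
    ... | inj₁ i₁ | inj₂ j₂ = ⊥-elim (disjoint (elem-sat E i₁) (subst Q (sym eq) (elem-sat F j₂)))
    ... | inj₂ i₂ | inj₁ j₁ = ⊥-elim (disjoint (elem-sat E j₁) (subst Q eq (elem-sat F i₂)))

    index⊎ : ∀ x → P x ⊎ Q x → Σ (Fin (k + m)) λ i → elem⊎ i ≡ x
    index⊎ x (inj₁ px) = let i , eq = index-of E x px in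
      i ↑ˡ m , trans (cong [ elem E , elem F ]′ (splitAt-↑ˡ k i m)) eq
    index⊎ x (inj₂ qx) = let i , eq = index-of F x qx in
      k ↑ʳ i , trans (cong [ elem E , elem F ]′ (splitAt-↑ʳ k m i)) eq

  ⊎-enumeration : Enumeration (λ x → P x ⊎ Q x) (k + m)
  ⊎-enumeration = record
    { elem = elem⊎ ; elem-sat = elem⊎-sat ; elem-injective = elem⊎-injective ; index-of = index⊎ }

module _ {X : Set} {n k m : ℕ} {P : X → Set} {Q : Vec X n → Set}
         (E : Enumeration P k) (F : Enumeration Q m) where

  private
    elem∷ : Fin (k * m) → Vec X (suc n)
    elem∷ i = elem E (proj₁ (remQuot {k} m i)) ∷ elem F (proj₂ (remQuot {k} m i))

    elem∷-injective : Injective _≡_ _≡_ elem∷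
    elem∷-injective {i} {j} eq = begin
      i                                  ≡⟨ combine-remQuot {k} m i ⟨
      uncurry combine (remQuot {k} m i)  ≡⟨ cong₂ combine (elem-injective E (cong head eq)) (elem-injective F (cong tail eq)) ⟩
      uncurry combine (remQuot {k} m j)  ≡⟨ combine-remQuot {k} m j ⟩
      j                                  ∎
      where open ≡-Reasoning

    index∷ : ∀ xs → P (head xs) × Q (tail xs) → Σ (Fin (k * m)) λ i → elem∷ i ≡ xs
    index∷ (x ∷ xs) (px , qxs) =
      let i , eqi = index-of E x px ; j , eqj = index-of F xs qxs in
      combine i j , trans (cong (λ r → elem E (proj₁ r) ∷ elem F (proj₂ r)) (remQuot-combine i j)) (cong₂ _∷_ eqi eqj)

  ∷-enumeration : Enumeration (λ xs → P (head xs) × Q (tail xs)) (k * m)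
  ∷-enumeration = record
    { elem = elem∷ ; elem-sat = λ i → elem-sat E _ , elem-sat F _ ; elem-injective = elem∷-injective ; index-of = index∷ }

[]-enumeration : ∀ {X : Set} → Enumeration {Vec X 0} (λ _ → ⊤) 1
[]-enumeration = record
  { elem = λ _ → [] ; elem-sat = λ _ → tt ; elem-injective = λ { {zero} {zero} _ → refl }
  ; index-of = λ { [] _ → zero , refl } }

All-enumeration : ∀ {X : Set} {P : X → Set} {k} → Enumeration P k → ∀ n → Enumeration (All P {n}) (k ^ n)
All-enumeration E zero    = enumeration-⇔ (λ { {[]} _ → [] }) (λ _ → tt) []-enumeration
All-enumeration E (suc n) =
  enumeration-⇔ (λ { {_ ∷ _} (p , ps) → p ∷ ps }) (λ { (p ∷ ps) → p , ps }) (∷-enumeration E (All-enumeration E n))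

-- Echelon vectors

data Echelon {X : Set} (Pre Piv Tail : X → Set) : ∀ {n} → Vec X n → Set where
  skip  : ∀ {n x} {xs : Vec X n} → Pre x → Echelon Pre Piv Tail xs → Echelon Pre Piv Tail (x ∷ xs)
  pivot : ∀ {n x} {xs : Vec X n} → Piv x → All Tail xs → Echelon Pre Piv Tail (x ∷ xs)

echelonCount : ℕ → ℕ → ℕ → ℕ → ℕ
echelonCount p q t zero    = 0
echelonCount p q t (suc n) = p * echelonCount p q t n + q * t ^ n

echelonCount-closed : ∀ p d q n → echelonCount p q (p + d) n * d + q * p ^ n ≡ q * (p + d) ^ n
echelonCount-closed p d q zero    = refl
echelonCount-closed p d q (suc n) = begin
  (p * E + q * t ^ n) * d + q * (p * p ^ n)  ≡⟨ regroup p d q E (t ^ n) (p ^ n) ⟩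
  p * (E * d + q * p ^ n) + q * t ^ n * d     ≡⟨ cong (λ x → p * x + q * t ^ n * d) (echelonCount-closed p d q n) ⟩
  p * (q * t ^ n) + q * t ^ n * d             ≡⟨ factor p d q (t ^ n) ⟩
  q * ((p + d) * t ^ n)                       ∎
  where
  open ≡-Reasoning
  t = p + d
  E = echelonCount p q t n
  regroup : ∀ p d q E x y → (p * E + q * x) * d + q * (p * y) ≡ p * (E * d + q * y) + q * x * d
  regroup = solve-∀
  factor : ∀ p d q x → p * (q * x) + q * x * d ≡ q * ((p + d) * x)
  factor = solve-∀

module _ {X : Set} {Pre Piv Tail : X → Set} {p q t : ℕ}
         (pre : Enumeration Pre p) (piv : Enumeration Piv q) (tl : Enumeration Tail t)
         (pre-piv-disjoint : ∀ {x} → Pre x → Piv x → ⊥) where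

  echelon-enumeration : ∀ n → Enumeration (Echelon Pre Piv Tail {n}) (echelonCount p q t n)
  echelon-enumeration zero    = enumeration-⇔ ⊥-elim (λ ()) (record
    { elem = λ () ; elem-sat = λ () ; elem-injective = λ { {()} } ; index-of = λ _ () })
  echelon-enumeration (suc n) = enumeration-⇔ to from
    (⊎-enumeration (∷-enumeration pre (echelon-enumeration n)) (∷-enumeration piv (All-enumeration tl n))
                   (λ (px , _) (qx , _) → pre-piv-disjoint px qx))
    where
    Split : Vec X (suc n) → Set
    Split xs = (Pre (head xs) × Echelon Pre Piv Tail (tail xs)) ⊎ (Piv (head xs) × All Tail (tail xs))
    to : ∀ {xs} → Split xs → Echelon Pre Piv Tail xs
    to {_ ∷ _} (inj₁ (px , ech)) = skip px ech
    to {_ ∷ _} (inj₂ (qx , ts))  = pivot qx ts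
    from : ∀ {xs} → Echelon Pre Piv Tail xs → Split xs
    from (skip px ech) = inj₁ (px , ech)
    from (pivot qx ts) = inj₂ (qx , ts)

module _ {X : Set} {Pre Piv Tail Q : X → Set} where

  echelon-All : (∀ {x} → Pre x → Q x) → (∀ {x} → Piv x → Q x) → (∀ {x} → Tail x → Q x) →
                ∀ {n} {xs : Vec X n} → Echelon Pre Piv Tail xs → All Q xs
  echelon-All pre piv tl (skip px ech) = pre px ∷ echelon-All pre piv tl ech
  echelon-All pre piv tl (pivot qx ts) = piv qx ∷ All.map tl ts

  echelon-¬All : (∀ {x} → Piv x → ¬ Q x) → ∀ {n} {xs : Vec X n} → Echelon Pre Piv Tail xs → ¬ All Q xs
  echelon-¬All piv (skip _ ech) (_ ∷ qs) = echelon-¬All piv ech qs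
  echelon-¬All piv (pivot qx _) (q ∷ _)  = piv qx q

module _ {X : Set} {R : X → X → Set} {P : X → Set} where

  Pointwise-All : (∀ {x y} → R x y → P x → P y) → ∀ {n} {xs ys : Vec X n} → Pointwise R xs ys → All P xs → All P ys
  Pointwise-All preserves []       []       = []
  Pointwise-All preserves (r ∷ rs) (p ∷ ps) = preserves r p ∷ Pointwise-All preserves rs ps

  Pointwise-All⁻ : (∀ {x y} → R x y → P y → P x) → ∀ {n} {xs ys : Vec X n} → Pointwise R xs ys → All P ys → All P xs
  Pointwise-All⁻ reflects []       []       = []
  Pointwise-All⁻ reflects (r ∷ rs) (p ∷ ps) = reflects r p ∷ Pointwise-All⁻ reflects rs ps

  All-rigid : (∀ {x y} → R x y → P x → P y → x ≡ y) →
              ∀ {n} {xs ys : Vec X n} → Pointwise R xs ys → All P xs → All P ys → xs ≡ ys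
  All-rigid rigid []       []       []       = refl
  All-rigid rigid (r ∷ rs) (p ∷ ps) (q ∷ qs) = cong₂ _∷_ (rigid r p q) (All-rigid rigid rs ps qs)

Pointwise-map : ∀ {X Y : Set} {R : X → Y → Set} (f : Y → X) → (∀ y → R (f y) y) →
                ∀ {n} (ys : Vec Y n) → Pointwise R (map f ys) ys
Pointwise-map f r []       = []
Pointwise-map f r (y ∷ ys) = r y ∷ Pointwise-map f r ys

module EchelonRigidity {X : Set} {Pre Piv Tail : X → Set} (R : X → X → Set) (Stable : Set)
  (pre-piv    : ∀ {x y} → R x y → Pre x → Piv y → ⊥)
  (piv-pre    : ∀ {x y} → R x y → Piv x → Pre y → ⊥)
  (piv-stable : ∀ {x y} → R x y → Piv x → Piv y → Stable)
  (pre-rigid  : Stable → ∀ {x y} → R x y → Pre x → Pre y → x ≡ y)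
  (piv-rigid  : Stable → ∀ {x y} → R x y → Piv x → Piv y → x ≡ y)
  (tail-rigid : Stable → ∀ {x y} → R x y → Tail x → Tail y → x ≡ y)
  where

  private
    Ech : ∀ {n} → Vec X n → Set
    Ech = Echelon Pre Piv Tail

  echelon-stable : ∀ {n} {xs ys : Vec X n} → Pointwise R xs ys → Ech xs → Ech ys → Stable
  echelon-stable (r ∷ rs) (skip _ ech) (skip _ ech′) = echelon-stable rs ech ech′
  echelon-stable (r ∷ rs) (skip px _)  (pivot qy _)  = ⊥-elim (pre-piv r px qy)
  echelon-stable (r ∷ rs) (pivot qx _) (skip py _)   = ⊥-elim (piv-pre r qx py)
  echelon-stable (r ∷ rs) (pivot qx _) (pivot qy _)  = piv-stable r qx qy

  echelon-rigid-when-stable : Stable → ∀ {n} {xs ys : Vec X n} → Pointwise R xs ys → Ech xs → Ech ys → xs ≡ ys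
  echelon-rigid-when-stable s (r ∷ rs) (skip px ech)  (skip py ech′) =
    cong₂ _∷_ (pre-rigid s r px py) (echelon-rigid-when-stable s rs ech ech′)
  echelon-rigid-when-stable s (r ∷ rs) (pivot qx ts) (pivot qy ts′) =
    cong₂ _∷_ (piv-rigid s r qx qy) (All-rigid (tail-rigid s) rs ts ts′)
  echelon-rigid-when-stable s (r ∷ rs) (skip px _)   (pivot qy _)   = ⊥-elim (pre-piv r px qy)
  echelon-rigid-when-stable s (r ∷ rs) (pivot qx _)  (skip py _)    = ⊥-elim (piv-pre r qx py)

  echelon-rigid : ∀ {n} {xs ys : Vec X n} → Pointwise R xs ys → Ech xs → Ech ys → xs ≡ ys
  echelon-rigid rs ech ech′ = echelon-rigid-when-stable (echelon-stable rs ech ech′) rs ech ech′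

  All-pre-echelon-disjoint : ∀ {n} {xs ys : Vec X n} → Pointwise R xs ys → All Pre xs → Ech ys → ⊥
  All-pre-echelon-disjoint (r ∷ rs) (_ ∷ ps) (skip _ ech) = All-pre-echelon-disjoint rs ps ech
  All-pre-echelon-disjoint (r ∷ rs) (p ∷ _)  (pivot q _)  = pre-piv r p q

  echelon-All-pre-disjoint : ∀ {n} {xs ys : Vec X n} → Pointwise R xs ys → Ech xs → All Pre ys → ⊥
  echelon-All-pre-disjoint (r ∷ rs) (skip _ ech) (_ ∷ ps) = echelon-All-pre-disjoint rs ech ps
  echelon-All-pre-disjoint (r ∷ rs) (pivot q _)  (p ∷ _)  = piv-pre r q p

data FirstFailure {X : Set} (Q : X → Set) : ∀ {n} → Vec X n → Set where
  fails : ∀ {n x} {xs : Vec X n} → ¬ Q x → FirstFailure Q (x ∷ xs)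
  holds : ∀ {n x} {xs : Vec X n} → Q x → FirstFailure Q xs → FirstFailure Q (x ∷ xs)

module _ {X : Set} {Q : X → Set} where

  All-or-FirstFailure : Decidable Q → ∀ {n} (xs : Vec X n) → All Q xs ⊎ FirstFailure Q xs
  All-or-FirstFailure Q? []       = inj₁ []
  All-or-FirstFailure Q? (x ∷ xs) with Q? x | All-or-FirstFailure Q? xs
  ... | no ¬q | _       = inj₂ (fails ¬q)
  ... | yes q | inj₁ qs = inj₁ (q ∷ qs)
  ... | yes q | inj₂ w  = inj₂ (holds q w)

  failure : ∀ {n} {xs : Vec X n} → FirstFailure Q xs → X
  failure (fails {x = x} _) = x
  failure (holds _ w)       = failure w

  failure-fails : ∀ {n} {xs : Vec X n} (w : FirstFailure Q xs) → ¬ Q (failure w)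
  failure-fails (fails ¬q)  = ¬q
  failure-fails (holds _ w) = failure-fails w

  All-failure : ∀ {P : X → Set} {n} {xs : Vec X n} → All P xs → (w : FirstFailure Q xs) → P (failure w)
  All-failure (p ∷ _)  (fails _)   = p
  All-failure (_ ∷ ps) (holds _ w) = All-failure ps w

  echelon-map : ∀ {Y : Set} {Pre Piv Tail : Y → Set} (f : X → Y) → (∀ {x} → Q x → Pre (f x)) →
                ∀ {n} {xs : Vec X n} (w : FirstFailure Q xs) → Piv (f (failure w)) → All (Tail ∘ f) xs →
                Echelon Pre Piv Tail (map f xs)
  echelon-map f pre (fails _)   piv (_ ∷ ts) = pivot piv (map⁺ ts)
  echelon-map f pre (holds q w) piv (_ ∷ ts) = skip (pre q) (echelon-map f pre w piv ts)

-- Coordinates of G n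

Coord : Set
Coord = Fin 3 × Fin 9

𝟘 : Coord
𝟘 = zero , zero

infixl 6 _+₃_
infix  8 _×₃_

_+₃_ : Fin 3 → Fin 3 → Fin 3
_+₃_ = addMod 3

-₃_ : Fin 3 → Fin 3
-₃_ = negMod 3

_×₃_ : ℕ → Fin 3 → Fin 3
m ×₃ x = fold zero (x +₃_) m

-- The group law of Defs on a single coordinate; the ℤ/3ℤ-components of the left factor (x) and of
-- the conjugator (z) enter as parameters.
mulᶜ : Fin 3 → Coord → Coord → Coord
mulᶜ x (c₁ , v₁) (c₂ , v₂) = c₁ +₃ c₂ +₃ mul3 x (red v₂) , addMod 9 v₁ v₂

invᶜ : Fin 3 → Coord → Coord
invᶜ x (c₁ , v₁) = (-₃ c₁) +₃ (-₃ mul3 x (red (negMod 9 v₁))) , negMod 9 v₁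

conjᶜ : Fin 3 → Fin 3 → Coord → Coord → Coord
conjᶜ z x k l = mulᶜ (z +₃ x) (mulᶜ z k l) (invᶜ z k)

powᶜ : Fin 3 → ℕ → Coord → Coord
powᶜ x m l = fold 𝟘 (mulᶜ x l) m

-- The coordinate of y · gᵐ · y⁻¹, where g has ℤ/3ℤ-component x and coordinate l, and y has
-- ℤ/3ℤ-component z and coordinate k.
twistᶜ : Fin 3 → Fin 3 → ℕ → Coord → Coord → Coord
twistᶜ z x m k l = conjᶜ z (m ×₃ x) k (powᶜ x m l)

record Twisted (z x : Fin 3) (m : ℕ) (l l′ : Coord) : Set where
  constructor twisted-by
  field
    conjugator : Coord
    twist-≡    : l′ ≡ twistᶜ z x m conjugator l

glue : ∀ {n} → Fin 3 → Vec Coord n → G n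
glue x ls = mkG (map proj₁ ls) (mkA x (map proj₂ ls))

private
  cons : ∀ {n} → Coord → G n → G (suc n)
  cons (c₁ , v₁) (mkG cs (mkA x vs)) = mkG (c₁ ∷ cs) (mkA x (v₁ ∷ vs))

  first : ∀ {n} → G (suc n) → Coord
  first g = head (c g) , head (b (a g))

  rest : ∀ {n} → G (suc n) → G n
  rest g = mkG (tail (c g)) (mkA (a₀ (a g)) (tail (b (a g))))

glue-injective : ∀ {n x x′} {ls ls′ : Vec Coord n} → glue x ls ≡ glue x′ ls′ → x ≡ x′ × ls ≡ ls′
glue-injective {ls = []}    {[]}    eq = cong (a₀ ∘ a) eq , refl
glue-injective {ls = _ ∷ _} {_ ∷ _} eq =
  let x≡x′ , ls≡ls′ = glue-injective (cong rest eq) in x≡x′ , cong₂ _∷_ (cong first eq) ls≡ls′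

glue-split : ∀ {n} (g : G n) → glue (a₀ (a g)) (zip (c g) (b (a g))) ≡ g
glue-split (mkG []       (mkA x []))       = refl
glue-split (mkG (_ ∷ cs) (mkA x (_ ∷ vs))) = cong (cons _) (glue-split (mkG cs (mkA x vs)))

glue-elim : ∀ {n} (P : G n → Set) → (∀ x ls → P (glue x ls)) → ∀ g → P g
glue-elim P P-glue g = subst P (glue-split g) (P-glue _ _)

glue-· : ∀ {n} x x′ (ls ls′ : Vec Coord n) → glue x ls · glue x′ ls′ ≡ glue (x +₃ x′) (zipWith (mulᶜ x) ls ls′)
glue-· x x′ []       []         = refl
glue-· x x′ (l ∷ ls) (l′ ∷ ls′) = cong (cons (mulᶜ x l l′)) (glue-· x x′ ls ls′)

glue-inv : ∀ {n} x (ls : Vec Coord n) → inv (glue x ls) ≡ glue (-₃ x) (map (invᶜ x) ls)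
glue-inv x []       = refl
glue-inv x (l ∷ ls) = cong (cons (invᶜ x l)) (glue-inv x ls)

glue-e : ∀ {n} → e {n} ≡ glue zero (replicate n 𝟘)
glue-e {zero}  = refl
glue-e {suc n} = cong (cons 𝟘) (glue-e {n})

glue-pow : ∀ {n} x (ls : Vec Coord n) m → pow (glue x ls) m ≡ glue (m ×₃ x) (map (powᶜ x m) ls)
glue-pow x ls zero    = trans glue-e (cong (glue zero) (sym (map-const ls 𝟘)))
glue-pow x ls (suc m) = begin
  glue x ls · pow (glue x ls) m                               ≡⟨ cong (glue x ls ·_) (glue-pow x ls m) ⟩
  glue x ls · glue (m ×₃ x) (map (powᶜ x m) ls)               ≡⟨ glue-· x _ ls _ ⟩
  glue (suc m ×₃ x) (zipWith (mulᶜ x) ls (map (powᶜ x m) ls)) ≡⟨ cong (glue _) (zipWith-diagonal ls) ⟩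
  glue (suc m ×₃ x) (map (powᶜ x (suc m)) ls)                 ∎
  where
  open ≡-Reasoning
  zipWith-diagonal : ∀ {k} (ls : Vec Coord k) → zipWith (mulᶜ x) ls (map (powᶜ x m) ls) ≡ map (powᶜ x (suc m)) ls
  zipWith-diagonal []       = refl
  zipWith-diagonal (l ∷ ls) = cong (_ ∷_) (zipWith-diagonal ls)

glue-conj : ∀ {n} z x (ks ls : Vec Coord n) →
            (glue z ks · glue x ls) · inv (glue z ks) ≡ glue x (zipWith (conjᶜ z x) ks ls)
glue-conj z x ks ls = begin
  (glue z ks · glue x ls) · inv (glue z ks)
    ≡⟨ cong₂ _·_ (glue-· z x ks ls) (glue-inv z ks) ⟩
  glue (z +₃ x) (zipWith (mulᶜ z) ks ls) · glue (-₃ z) (map (invᶜ z) ks)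
    ≡⟨ glue-· (z +₃ x) (-₃ z) _ _ ⟩
  glue (z +₃ x +₃ (-₃ z)) (zipWith (mulᶜ (z +₃ x)) (zipWith (mulᶜ z) ks ls) (map (invᶜ z) ks))
    ≡⟨ cong₂ glue (+₃-conj z x) (zipWith-conj ks ls) ⟩
  glue x (zipWith (conjᶜ z x) ks ls) ∎
  where
  open ≡-Reasoning
  +₃-conj : ∀ z x → z +₃ x +₃ (-₃ z) ≡ x
  +₃-conj = from-yes (all? λ z → all? λ x → z +₃ x +₃ (-₃ z) ≟ x)
  zipWith-conj : ∀ {k} (ks ls : Vec Coord k) →
                 zipWith (mulᶜ (z +₃ x)) (zipWith (mulᶜ z) ks ls) (map (invᶜ z) ks) ≡ zipWith (conjᶜ z x) ks ls
  zipWith-conj []       []       = refl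
  zipWith-conj (k ∷ ks) (l ∷ ls) = cong (_ ∷_) (zipWith-conj ks ls)

glue-twist : ∀ {n} z x m (ks ls : Vec Coord n) →
             (glue z ks · pow (glue x ls) m) · inv (glue z ks) ≡ glue (m ×₃ x) (zipWith (twistᶜ z x m) ks ls)
glue-twist z x m ks ls = begin
  (glue z ks · pow (glue x ls) m) · inv (glue z ks)
    ≡⟨ cong (λ h → (glue z ks · h) · inv (glue z ks)) (glue-pow x ls m) ⟩
  (glue z ks · glue (m ×₃ x) (map (powᶜ x m) ls)) · inv (glue z ks)
    ≡⟨ glue-conj z (m ×₃ x) ks _ ⟩
  glue (m ×₃ x) (zipWith (conjᶜ z (m ×₃ x)) ks (map (powᶜ x m) ls))
    ≡⟨ cong (glue _) (zipWith-map₂ (conjᶜ z (m ×₃ x)) (powᶜ x m) ks ls) ⟩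
  glue (m ×₃ x) (zipWith (twistᶜ z x m) ks ls) ∎
  where open ≡-Reasoning

module _ {z x : Fin 3} {m : ℕ} where

  zipWith-Twisted : ∀ {n} (ks ls : Vec Coord n) → Pointwise (Twisted z x m) ls (zipWith (twistᶜ z x m) ks ls)
  zipWith-Twisted []       []       = []
  zipWith-Twisted (k ∷ ks) (l ∷ ls) = twisted-by k refl ∷ zipWith-Twisted ks ls

  Twisted-zipWith : ∀ {n} {ls ls′ : Vec Coord n} → Pointwise (Twisted z x m) ls ls′ →
                    Σ (Vec Coord n) λ ks → ls′ ≡ zipWith (twistᶜ z x m) ks ls
  Twisted-zipWith []                     = [] , refl
  Twisted-zipWith (twisted-by k eq ∷ rs) = let ks , eqs = Twisted-zipWith rs in k ∷ ks , cong₂ _∷_ eq eqs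

  Twisted⇒conj-glue : ∀ {n} {ls ls′ : Vec Coord n} → Pointwise (Twisted z x m) ls ls′ →
                      Conj (pow (glue x ls) m) (glue (m ×₃ x) ls′)
  Twisted⇒conj-glue {ls = ls} rs =
    let ks , ls′≡ = Twisted-zipWith rs in
    glue z ks , trans (cong (glue _) ls′≡) (sym (glue-twist z x m ks ls))

module _ {n} {x x′ : Fin 3} {ls ls′ : Vec Coord n} (m : ℕ) where

  conj-glue-x : Conj (pow (glue x ls) m) (glue x′ ls′) → x′ ≡ m ×₃ x
  conj-glue-x (y , eq) = glue-elim Goal x-part y eq
    where
    Goal : G n → Set
    Goal y = glue x′ ls′ ≡ (y · pow (glue x ls) m) · inv y → x′ ≡ m ×₃ x
    x-part : ∀ z ks → Goal (glue z ks)
    x-part z ks eq = proj₁ (glue-injective (trans eq (glue-twist z x m ks ls)))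

  conj-glue-Twisted : Conj (pow (glue x ls) m) (glue x′ ls′) → Σ (Fin 3) λ z → Pointwise (Twisted z x m) ls ls′
  conj-glue-Twisted (y , eq) = glue-elim Goal twisted y eq
    where
    Goal : G n → Set
    Goal y = glue x′ ls′ ≡ (y · pow (glue x ls) m) · inv y → Σ (Fin 3) λ z → Pointwise (Twisted z x m) ls ls′
    twisted : ∀ z ks → Goal (glue z ks)
    twisted z ks eq = z , subst (Pointwise (Twisted z x m) ls) (sym (proj₂ (glue-injective (trans eq (glue-twist z x m ks ls)))))
                                (zipWith-Twisted ks ls)

-- Powers, units of ℤ/9ℤ and orders

_≟ᶜ_ : DecidableEquality Coord
_≟ᶜ_ = ×-≡-dec _≟_ _≟_

open import Data.Vec.Membership.DecPropositional _≟ᶜ_ using (_∈?_)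

∀ᶜ? : {P : Coord → Set} → Decidable P → Dec (∀ l → P l)
∀ᶜ? P? = map′ (λ h (c₁ , v₁) → h c₁ v₁) (λ h c₁ v₁ → h (c₁ , v₁))
               (all? λ c₁ → all? λ v₁ → P? (c₁ , v₁))

∃ᶜ? : {P : Coord → Set} → Decidable P → Dec (Σ Coord P)
∃ᶜ? P? = map′ (λ (c₁ , v₁ , p) → (c₁ , v₁) , p) (λ ((c₁ , v₁) , p) → c₁ , v₁ , p)
               (any? λ c₁ → any? λ v₁ → P? (c₁ , v₁))

-- The units of ℤ/9ℤ, listed so that unitVal (opposite u) = 9 ∸ unitVal u.
unitVal : Fin 6 → ℕ
unitVal = lookup (1 ∷ 2 ∷ 4 ∷ 5 ∷ 7 ∷ 8 ∷ [])

periodic-% : ∀ {X : Set} p .{{_ : NonZero p}} (f : ℕ → X) → (∀ m → f (p + m) ≡ f m) → ∀ m → f m ≡ f (m % p)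
periodic-% p f period m = trans (cong f (m≡m%n+[m/n]*n m p)) (shift (m % p) (m / p))
  where
  swap : ∀ r p q → r + (p + q) ≡ p + (r + q)
  swap = solve-∀
  shift : ∀ r q → f (r + q * p) ≡ f r
  shift r zero    = cong f (+-identityʳ r)
  shift r (suc q) = trans (cong f (swap r p (q * p))) (trans (period (r + q * p)) (shift r q))

unit-residue : ∀ m → ¬ 3 ∣ m → Σ (Fin 6) λ u → m % 9 ≡ unitVal u
unit-residue m 3∤m = let u , eq = residues (fromℕ< (m%n<n m 9)) 3∤r in u , trans (sym (toℕ-fromℕ< _)) eq
  where
  residues : ∀ (r : Fin 9) → ¬ 3 ∣ toℕ r → Σ (Fin 6) λ u → toℕ r ≡ unitVal u
  residues = from-yes (all? λ (r : Fin 9) → ¬? (3 ∣? toℕ r) →-dec any? λ u → toℕ r ≟ℕ unitVal u)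
  3∤r : ¬ 3 ∣ toℕ (fromℕ< (m%n<n m 9))
  3∤r 3∣r = 3∤m (∣n∣m%n⇒∣m (divides 3 refl) (subst (3 ∣_) (toℕ-fromℕ< _) 3∣r))

×₃-period : ∀ x m → (9 + m) ×₃ x ≡ m ×₃ x
×₃-period x m = trans (fold-+ zero (x +₃_) 9 {m}) (+₃-order x _)
  where
  +₃-order : ∀ x k → fold k (x +₃_) 9 ≡ k
  +₃-order = from-yes (all? λ x → all? λ k → fold k (x +₃_) 9 ≟ k)

powᶜ-period : ∀ x m l → powᶜ x (9 + m) l ≡ powᶜ x m l
powᶜ-period x m l = trans (fold-+ 𝟘 (mulᶜ x l) 9 {m}) (mulᶜ-order x l _)
  where
  mulᶜ-order : ∀ x l k → fold k (mulᶜ x l) 9 ≡ k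
  mulᶜ-order = from-yes (all? λ x → ∀ᶜ? λ l → ∀ᶜ? λ k → fold k (mulᶜ x l) 9 ≟ᶜ k)

pow-period : ∀ {n} (g : G n) m → pow g (9 + m) ≡ pow g m
pow-period = glue-elim (λ g → ∀ m → pow g (9 + m) ≡ pow g m) λ x ls m → begin
  pow (glue x ls) (9 + m)                       ≡⟨ glue-pow x ls (9 + m) ⟩
  glue ((9 + m) ×₃ x) (map (powᶜ x (9 + m)) ls) ≡⟨ cong₂ glue (×₃-period x m) (map-cong (powᶜ-period x m) ls) ⟩
  glue (m ×₃ x) (map (powᶜ x m) ls)             ≡⟨ glue-pow x ls m ⟨
  pow (glue x ls) m                             ∎
  where open ≡-Reasoning

pow-unit : ∀ {n} (g : G n) m → ¬ 3 ∣ m → Σ (Fin 6) λ u → pow g m ≡ pow g (unitVal u)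
pow-unit g m 3∤m = let u , eq = unit-residue m 3∤m in
  u , trans (periodic-% 9 (pow g) (pow-period g) m) (cong (pow g) eq)

pow-inv-unit : ∀ {n} (g : G n) u → pow (inv g) (unitVal u) ≡ pow g (unitVal (opposite u))
pow-inv-unit g u = glue-elim (λ g → pow (inv g) (unitVal u) ≡ pow g (unitVal (opposite u))) (λ x ls → begin
  pow (inv (glue x ls)) (unitVal u)                                ≡⟨ cong (λ h → pow h (unitVal u)) (glue-inv x ls) ⟩
  pow (glue (-₃ x) (map (invᶜ x) ls)) (unitVal u)                  ≡⟨ glue-pow (-₃ x) _ (unitVal u) ⟩
  glue (unitVal u ×₃ (-₃ x)) (map (powᶜ (-₃ x) (unitVal u)) (map (invᶜ x) ls))
    ≡⟨ cong₂ glue (×₃-neg u x) (trans (sym (map-∘ _ _ ls)) (map-cong (powᶜ-inv u x) ls)) ⟩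
  glue (unitVal (opposite u) ×₃ x) (map (powᶜ x (unitVal (opposite u))) ls) ≡⟨ glue-pow x ls _ ⟨
  pow (glue x ls) (unitVal (opposite u))                           ∎) g
  where
  open ≡-Reasoning
  ×₃-neg : ∀ u x → unitVal u ×₃ (-₃ x) ≡ unitVal (opposite u) ×₃ x
  ×₃-neg = from-yes (all? λ u → all? λ x → unitVal u ×₃ (-₃ x) ≟ unitVal (opposite u) ×₃ x)
  powᶜ-inv : ∀ u x l → powᶜ (-₃ x) (unitVal u) (invᶜ x l) ≡ powᶜ x (unitVal (opposite u)) l
  powᶜ-inv = from-yes (all? λ u → all? λ x → ∀ᶜ? λ l →
    powᶜ (-₃ x) (unitVal u) (invᶜ x l) ≟ᶜ powᶜ x (unitVal (opposite u)) l)

zpow-unit : ∀ {n} (g : G n) k → ¬ 3 ∣ ∣ k ∣ → Σ (Fin 6) λ u → zpow g k ≡ pow g (unitVal u)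
zpow-unit g (+ m)    3∤m = pow-unit g m 3∤m
zpow-unit g -[1+ m ] 3∤m = let u , eq = pow-unit (inv g) (suc m) 3∤m in opposite u , trans eq (pow-inv-unit g u)

_≟G_ : ∀ {n} → DecidableEquality (G n)
mkG cs (mkA x vs) ≟G mkG cs′ (mkA x′ vs′) =
  map′ (λ (p , q , r) → cong₂ mkG p (cong₂ mkA q r)) (λ { refl → refl , refl , refl })
       (Vec-≡-dec _≟_ cs cs′ ×-dec x ≟ x′ ×-dec Vec-≡-dec _≟_ vs vs′)

module _ {X : Set} {x₀ : X} where

  All-≡⇒≡replicate : ∀ {n} {xs : Vec X n} → All (_≡ x₀) xs → xs ≡ replicate n x₀
  All-≡⇒≡replicate []       = refl
  All-≡⇒≡replicate (p ∷ ps) = cong₂ _∷_ p (All-≡⇒≡replicate ps)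

  ≡replicate⇒All-≡ : ∀ {n} (xs : Vec X n) → xs ≡ replicate n x₀ → All (_≡ x₀) xs
  ≡replicate⇒All-≡ []       _  = []
  ≡replicate⇒All-≡ (x ∷ xs) eq = cong head eq ∷ ≡replicate⇒All-≡ xs (cong tail eq)

glue-≡e : ∀ {n x} {ls : Vec Coord n} → glue x ls ≡ e → x ≡ zero × All (_≡ 𝟘) ls
glue-≡e eq = let x≡0 , ls≡𝟘 = glue-injective (trans eq glue-e) in x≡0 , ≡replicate⇒All-≡ _ ls≡𝟘

≡e-glue : ∀ {n x} {ls : Vec Coord n} → x ≡ zero → All (_≡ 𝟘) ls → glue x ls ≡ e
≡e-glue refl ls≡𝟘 = trans (cong (glue zero) (All-≡⇒≡replicate ls≡𝟘)) (sym glue-e)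

pow-glue-≡e : ∀ {n} x (ls : Vec Coord n) m → pow (glue x ls) m ≡ e →
              m ×₃ x ≡ zero × All (λ l → powᶜ x m l ≡ 𝟘) ls
pow-glue-≡e x ls m eq = let x≡0 , ls≡𝟘 = glue-≡e (trans (sym (glue-pow x ls m)) eq) in x≡0 , map⁻ ls≡𝟘

≡e-pow-glue : ∀ {n} x (ls : Vec Coord n) m → m ×₃ x ≡ zero → All (λ l → powᶜ x m l ≡ 𝟘) ls →
              pow (glue x ls) m ≡ e
≡e-pow-glue x ls m x≡0 ls≡𝟘 = trans (glue-pow x ls m) (≡e-glue x≡0 (map⁺ ls≡𝟘))

pow-unit-≡e : ∀ {n} u (g : G n) → pow g (unitVal u) ≡ e → g ≡ e
pow-unit-≡e u = glue-elim (λ g → pow g (unitVal u) ≡ e → g ≡ e) λ x ls eq →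
  let x≡0 , ls≡𝟘 = pow-glue-≡e x ls (unitVal u) eq in
  ≡e-glue (×₃-unit u x x≡0) (All.map (λ {l} → powᶜ-unit u x l) ls≡𝟘)
  where
  ×₃-unit : ∀ u x → unitVal u ×₃ x ≡ zero → x ≡ zero
  ×₃-unit = from-yes (all? λ u → all? λ x → (unitVal u ×₃ x ≟ zero) →-dec (x ≟ zero))
  powᶜ-unit : ∀ u x l → powᶜ x (unitVal u) l ≡ 𝟘 → l ≡ 𝟘
  powᶜ-unit = from-yes (all? λ u → all? λ x → ∀ᶜ? λ l → (powᶜ x (unitVal u) l ≟ᶜ 𝟘) →-dec (l ≟ᶜ 𝟘))

pow-6⇒pow-3 : ∀ {n} (g : G n) → pow g 6 ≡ e → pow g 3 ≡ e
pow-6⇒pow-3 = glue-elim (λ g → pow g 6 ≡ e → pow g 3 ≡ e) λ x ls eq →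
  ≡e-pow-glue x ls 3 (×₃-3 x) (All.map (λ {l} → powᶜ-6⇒3 x l) (proj₂ (pow-glue-≡e x ls 6 eq)))
  where
  ×₃-3 : ∀ x → 3 ×₃ x ≡ zero
  ×₃-3 = from-yes (all? λ x → 3 ×₃ x ≟ zero)
  powᶜ-6⇒3 : ∀ x l → powᶜ x 6 l ≡ 𝟘 → powᶜ x 3 l ≡ 𝟘
  powᶜ-6⇒3 = from-yes (all? λ x → ∀ᶜ? λ l → (powᶜ x 6 l ≟ᶜ 𝟘) →-dec (powᶜ x 3 l ≟ᶜ 𝟘))

IsOrder-unique : ∀ {n} {g : G n} {k k′} → IsOrder g k → IsOrder g k′ → k ≡ k′
IsOrder-unique {k = k} {k′} (1≤k , gᵏ≡e , k-min) (1≤k′ , gᵏ′≡e , k′-min) with <-cmp k k′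
... | tri< k<k′ _ _ = ⊥-elim (k′-min k 1≤k k<k′ gᵏ≡e)
... | tri≈ _ k≡k′ _ = k≡k′
... | tri> _ _ k′<k = ⊥-elim (k-min k′ 1≤k′ k′<k gᵏ′≡e)

order-3∨9 : ∀ {n} (g : G n) → g ≢ e → Σ ℕ λ k → IsOrder g k × (k ≡ 3 ⊎ k ≡ 9)
order-3∨9 g g≢e with pow g 3 ≟G e
... | yes g³≡e = 3 , (s≤s z≤n , g³≡e , minimal) , inj₁ refl
  where
  minimal : ∀ m → 1 ≤ m → m < 3 → pow g m ≢ e
  minimal 1 _ _ = g≢e ∘ pow-unit-≡e (# 0) g
  minimal 2 _ _ = g≢e ∘ pow-unit-≡e (# 1) g
  minimal (suc (suc (suc _))) _ (s≤s (s≤s (s≤s ())))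
... | no g³≢e = 9 , (s≤s z≤n , pow-period g 0 , minimal) , inj₂ refl
  where
  minimal : ∀ m → 1 ≤ m → m < 9 → pow g m ≢ e
  minimal 1 _ _ = g≢e ∘ pow-unit-≡e (# 0) g
  minimal 2 _ _ = g≢e ∘ pow-unit-≡e (# 1) g
  minimal 3 _ _ = g³≢e
  minimal 4 _ _ = g≢e ∘ pow-unit-≡e (# 2) g
  minimal 5 _ _ = g≢e ∘ pow-unit-≡e (# 3) g
  minimal 6 _ _ = g³≢e ∘ pow-6⇒pow-3 g
  minimal 7 _ _ = g≢e ∘ pow-unit-≡e (# 4) g
  minimal 8 _ _ = g≢e ∘ pow-unit-≡e (# 5) g
  minimal (suc (suc (suc (suc (suc (suc (suc (suc (suc _))))))))) _
          (s≤s (s≤s (s≤s (s≤s (s≤s (s≤s (s≤s (s≤s (s≤s ())))))))))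

_⇝_ : ∀ {n} → G n → G n → Set
ρ ⇝ g = Σ (Fin 6) λ u → Conj (pow ρ (unitVal u)) g

∼⇒⇝ : ∀ {n} {g h : G n} → g ≢ e → g ∼ h → g ⇝ h
∼⇒⇝ {g = g} g≢e (k , k-order , j , j⊥k , conj) =
  let u , gʲ≡gᵘ = zpow-unit g j 3∤j in u , subst (λ y → Conj y _) gʲ≡gᵘ conj
  where
  3∣k : 3 ∣ k
  3∣k with order-3∨9 g g≢e
  ... | k′ , k′-order , inj₁ k′≡3 = subst (3 ∣_) (sym (trans (IsOrder-unique k-order k′-order) k′≡3)) (divides 1 refl)
  ... | k′ , k′-order , inj₂ k′≡9 = subst (3 ∣_) (sym (trans (IsOrder-unique k-order k′-order) k′≡9)) (divides 3 refl)
  3∤j : ¬ 3 ∣ ∣ j ∣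
  3∤j 3∣j with j⊥k (3∣j , 3∣k)
  ... | ()

⇝⇒∼ : ∀ {n} {g h : G n} → g ≢ e → g ⇝ h → g ∼ h
⇝⇒∼ {g = g} g≢e (u , conj) with order-3∨9 g g≢e
... | k , k-order , k≡3∨9 = k , k-order , + unitVal u , unit-coprime k≡3∨9 , conj
  where
  unit-coprime : ∀ {k} → k ≡ 3 ⊎ k ≡ 9 → Coprime (unitVal u) k
  unit-coprime (inj₁ refl) = from-yes (all? λ u → coprime? (unitVal u) 3) u
  unit-coprime (inj₂ refl) = from-yes (all? λ u → coprime? (unitVal u) 9) u

-- Canonical representatives

Kerπ : Coord → Set
Kerπ (_ , v₁) = red v₁ ≡ zero

Kerπ? : ∀ l → Dec (Kerπ l)
Kerπ? (_ , v₁) = red v₁ ≟ zero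

multiplesOf3 : Vec (Fin 9) 3
multiplesOf3 = # 0 ∷ # 3 ∷ # 6 ∷ []

kerπ : Vec Coord 9
kerπ = allPairs (allFin 3) multiplesOf3

coords : Vec Coord 27
coords = allPairs (allFin 3) (allFin 9)

-- One element of each pair {l, -l} of nonzero elements of Kerπ.
signReps : Vec Coord 4
signReps = (# 1 , # 0) ∷ (# 1 , # 3) ∷ (# 1 , # 6) ∷ (# 0 , # 3) ∷ []

axis : ∀ {k} → Vec (Fin 9) k → Vec Coord k
axis = map (zero ,_)

NormalKer NormalOff NormalX : ∀ {n} → Vec Coord n → Set
NormalKer = Echelon (_∈ 𝟘 ∷ []) (_∈ signReps) (_∈ kerπ)
NormalOff = Echelon (_∈ kerπ) (_∈ (zero , # 1) ∷ []) (_∈ coords)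
NormalX ls = All (_∈ axis multiplesOf3) ls
           ⊎ Echelon (_∈ axis multiplesOf3) (_∈ axis (# 1 ∷ # 2 ∷ [])) (_∈ axis (allFin 9)) ls

data Canonical {n} : G n → Set where
  ker : ∀ {ls} → NormalKer ls → Canonical (glue zero ls)
  off : ∀ {ls} → NormalOff ls → Canonical (glue zero ls)
  x≡1 : ∀ {ls} → NormalX ls → Canonical (glue (# 1) ls)

lookup-injective? : ∀ {k} (t : Vec Coord k) → Dec (∀ i j → lookup t i ≡ lookup t j → i ≡ j)
lookup-injective? t = all? λ i → all? λ j → (lookup t i ≟ᶜ lookup t j) →-dec (i ≟ j)

tableᶜ : ∀ {k} (t : Vec Coord k) → {True (lookup-injective? t)} → Enumeration (_∈ t) k
tableᶜ t {injective} = table-enumeration t (toWitness injective _ _)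

disjoint? : ∀ {k k′} (t : Vec Coord k) (t′ : Vec Coord k′) → Dec (∀ l → l ∈ t → ¬ l ∈ t′)
disjoint? t t′ = ∀ᶜ? λ l → (l ∈? t) →-dec ¬? (l ∈? t′)

disjointᶜ : ∀ {k k′} (t : Vec Coord k) (t′ : Vec Coord k′) → {True (disjoint? t t′)} →
            ∀ {l} → l ∈ t → l ∈ t′ → ⊥
disjointᶜ t t′ {disjoint} {l} = toWitness disjoint l

⊆Kerπ? : ∀ {k} (t : Vec Coord k) → Dec (∀ l → l ∈ t → Kerπ l)
⊆Kerπ? t = ∀ᶜ? λ l → (l ∈? t) →-dec Kerπ? l

⊆Kerπ : ∀ {k} (t : Vec Coord k) → {True (⊆Kerπ? t)} → ∀ l → l ∈ t → Kerπ l
⊆Kerπ t {⊆} = toWitness ⊆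

⊆¬Kerπ? : ∀ {k} (t : Vec Coord k) → Dec (∀ l → l ∈ t → ¬ Kerπ l)
⊆¬Kerπ? t = ∀ᶜ? λ l → (l ∈? t) →-dec ¬? (Kerπ? l)

⊆¬Kerπ : ∀ {k} (t : Vec Coord k) → {True (⊆¬Kerπ? t)} → ∀ l → l ∈ t → ¬ Kerπ l
⊆¬Kerπ t {⊆} = toWitness ⊆

countKer countOff countX : ℕ → ℕ
countKer = echelonCount 1 4 9
countOff = echelonCount 9 1 27
countX n = 3 ^ n + echelonCount 3 2 9 n

normalKer-enumeration : ∀ n → Enumeration (NormalKer {n}) (countKer n)
normalKer-enumeration = echelon-enumeration (tableᶜ _) (tableᶜ _) (tableᶜ _) (disjointᶜ _ _)

normalOff-enumeration : ∀ n → Enumeration (NormalOff {n}) (countOff n)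
normalOff-enumeration = echelon-enumeration (tableᶜ _) (tableᶜ _) (tableᶜ _) (disjointᶜ _ _)

normalX-enumeration : ∀ n → Enumeration (NormalX {n}) (countX n)
normalX-enumeration n = ⊎-enumeration (All-enumeration (tableᶜ _) n)
  (echelon-enumeration (tableᶜ _) (tableᶜ _) (tableᶜ _) pre-piv-disjoint n)
  (λ pres ech → echelon-¬All (λ piv pre → pre-piv-disjoint pre piv) ech pres)
  where
  pre-piv-disjoint : ∀ {l} → l ∈ axis multiplesOf3 → l ∈ axis (# 1 ∷ # 2 ∷ []) → ⊥
  pre-piv-disjoint = disjointᶜ (axis multiplesOf3) (axis (# 1 ∷ # 2 ∷ []))

normalKer-Kerπ : ∀ {n} {ls : Vec Coord n} → NormalKer ls → All Kerπ ls
normalKer-Kerπ = echelon-All (⊆Kerπ _ _) (⊆Kerπ _ _) (⊆Kerπ _ _)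

normalOff-¬Kerπ : ∀ {n} {ls : Vec Coord n} → NormalOff ls → ¬ All Kerπ ls
normalOff-¬Kerπ = echelon-¬All (⊆¬Kerπ _ _)

canonical-≢e : ∀ {n} {ρ : G n} → Canonical ρ → ρ ≢ e
canonical-≢e (ker p) ρ≡e =
  echelon-¬All (λ q l≡𝟘 → disjointᶜ (𝟘 ∷ []) signReps (here l≡𝟘) q) p (proj₂ (glue-≡e ρ≡e))
canonical-≢e (off p) ρ≡e = echelon-¬All (λ { (here refl) () }) p (proj₂ (glue-≡e ρ≡e))
canonical-≢e (x≡1 p) ρ≡e with () ← proj₁ (glue-≡e ρ≡e)

canonical-enumeration : ∀ n → Enumeration (Canonical {n}) (countKer n + (countOff n + countX n))
canonical-enumeration n = enumeration-⇔ to from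
  (⊎-enumeration (image-enumeration (glue zero) (proj₂ ∘ glue-injective) (normalKer-enumeration n))
    (⊎-enumeration (image-enumeration (glue zero) (proj₂ ∘ glue-injective) (normalOff-enumeration n))
                   (image-enumeration (glue (# 1)) (proj₂ ∘ glue-injective) (normalX-enumeration n))
                   off-x-disjoint)
    ker-disjoint)
  where
  Images : G n → Set
  Images g = Image (glue zero) NormalKer g ⊎ (Image (glue zero) NormalOff g ⊎ Image (glue (# 1)) NormalX g)
  off-x-disjoint : ∀ {g} → Image (glue zero) NormalOff g → Image (glue (# 1)) NormalX g → ⊥
  off-x-disjoint (_ , _ , refl) (_ , _ , eq) with () ← proj₁ (glue-injective eq)
  ker-disjoint : ∀ {g} → Image (glue zero) NormalKer g → Image (glue zero) NormalOff g ⊎ Image (glue (# 1)) NormalX g → ⊥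
  ker-disjoint (ls , p , refl) (inj₁ (ls′ , p′ , eq)) =
    normalOff-¬Kerπ p′ (subst (All Kerπ) (sym (proj₂ (glue-injective eq))) (normalKer-Kerπ p))
  ker-disjoint (_ , _ , refl) (inj₂ (_ , _ , eq)) with () ← proj₁ (glue-injective eq)
  to : ∀ {g} → Images g → Canonical g
  to (inj₁ (_ , p , refl))        = ker p
  to (inj₂ (inj₁ (_ , p , refl))) = off p
  to (inj₂ (inj₂ (_ , p , refl))) = x≡1 p
  from : ∀ {g} → Canonical g → Images g
  from (ker p) = inj₁ (_ , p , refl)
  from (off p) = inj₂ (inj₁ (_ , p , refl))
  from (x≡1 p) = inj₂ (inj₂ (_ , p , refl))

-- Rigidity of canonical representatives

_≡1mod3 : Fin 6 → Set
u ≡1mod3 = unitVal u % 3 ≡ 1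

_≡1mod3? : ∀ u → Dec (u ≡1mod3)
u ≡1mod3? = unitVal u % 3 ≟ℕ 1

twist-Kerπ : ∀ z x u k l → Kerπ l → Kerπ (twistᶜ z x (unitVal u) k l)
twist-Kerπ = from-yes (all? λ z → all? λ x → all? λ u → ∀ᶜ? λ k → ∀ᶜ? λ l →
  Kerπ? l →-dec Kerπ? (twistᶜ z x (unitVal u) k l))

twist-Kerπ⁻ : ∀ z x u k l → Kerπ (twistᶜ z x (unitVal u) k l) → Kerπ l
twist-Kerπ⁻ = from-yes (all? λ z → all? λ x → all? λ u → ∀ᶜ? λ k → ∀ᶜ? λ l →
  Kerπ? (twistᶜ z x (unitVal u) k l) →-dec Kerπ? l)

module _ {z x : Fin 3} (u : Fin 6) where

  Twisted-Kerπ : ∀ {l l′} → Twisted z x (unitVal u) l l′ → Kerπ l → Kerπ l′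
  Twisted-Kerπ {l} (twisted-by k refl) = twist-Kerπ z x u k l

  Twisted-Kerπ⁻ : ∀ {l l′} → Twisted z x (unitVal u) l l′ → Kerπ l′ → Kerπ l
  Twisted-Kerπ⁻ {l} (twisted-by k refl) = twist-Kerπ⁻ z x u k l

  module _ {P Q : Coord → Set} (P⊆Kerπ : ∀ l → P l → Kerπ l) (Q∩Kerπ : ∀ l → Q l → ¬ Kerπ l) where

    Kerπ-separated : ∀ {l l′} → Twisted z x (unitVal u) l l′ → P l → Q l′ → ⊥
    Kerπ-separated {l} {l′} r p q = Q∩Kerπ l′ q (Twisted-Kerπ r (P⊆Kerπ l p))

    Kerπ-separated⁻ : ∀ {l l′} → Twisted z x (unitVal u) l l′ → Q l → P l′ → ⊥
    Kerπ-separated⁻ {l} {l′} r q p = Q∩Kerπ l q (Twisted-Kerπ⁻ r (P⊆Kerπ l′ p))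

twist-𝟘 : ∀ z u k → twistᶜ z zero (unitVal u) k 𝟘 ≡ 𝟘
twist-𝟘 = from-yes (all? λ z → all? λ u → ∀ᶜ? λ k → twistᶜ z zero (unitVal u) k 𝟘 ≟ᶜ 𝟘)

ker-rigid : ∀ {n z u} {ls ls′ : Vec Coord n} → Pointwise (Twisted z zero (unitVal u)) ls ls′ →
            NormalKer ls → NormalKer ls′ → ls ≡ ls′
ker-rigid {z = z} {u} = EchelonRigidity.echelon-rigid (Twisted z zero (unitVal u)) (u ≡1mod3)
  pre-piv piv-pre piv-stable (rigid (𝟘 ∷ [])) (rigid signReps) (rigid kerπ)
  where
  twist-≡𝟘 : ∀ z u k l → twistᶜ z zero (unitVal u) k l ≡ 𝟘 → l ≡ 𝟘
  twist-≡𝟘 = from-yes (all? λ z → all? λ u → ∀ᶜ? λ k → ∀ᶜ? λ l →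
    (twistᶜ z zero (unitVal u) k l ≟ᶜ 𝟘) →-dec (l ≟ᶜ 𝟘))
  signReps-stable : ∀ z u k l → l ∈ signReps → twistᶜ z zero (unitVal u) k l ∈ signReps → u ≡1mod3
  signReps-stable = from-yes (all? λ z → all? λ u → ∀ᶜ? λ k → ∀ᶜ? λ l →
    (l ∈? signReps) →-dec (twistᶜ z zero (unitVal u) k l ∈? signReps) →-dec (u ≡1mod3?))
  twist-trivial : ∀ z u k l → u ≡1mod3 → Kerπ l → twistᶜ z zero (unitVal u) k l ≡ l
  twist-trivial = from-yes (all? λ z → all? λ u → ∀ᶜ? λ k → ∀ᶜ? λ l →
    (u ≡1mod3?) →-dec Kerπ? l →-dec (twistᶜ z zero (unitVal u) k l ≟ᶜ l))

  pre-piv : ∀ {l l′} → Twisted z zero (unitVal u) l l′ → l ∈ 𝟘 ∷ [] → l′ ∈ signReps → ⊥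
  pre-piv (twisted-by k refl) (here refl) = disjointᶜ (𝟘 ∷ []) signReps (here (twist-𝟘 z u k))
  piv-pre : ∀ {l l′} → Twisted z zero (unitVal u) l l′ → l ∈ signReps → l′ ∈ 𝟘 ∷ [] → ⊥
  piv-pre {l} (twisted-by k refl) l∈signReps (here l′≡𝟘) =
    disjointᶜ (𝟘 ∷ []) signReps (here (twist-≡𝟘 z u k l l′≡𝟘)) l∈signReps
  piv-stable : ∀ {l l′} → Twisted z zero (unitVal u) l l′ → l ∈ signReps → l′ ∈ signReps → u ≡1mod3
  piv-stable {l} (twisted-by k refl) = signReps-stable z u k l
  rigid : ∀ {j} (t : Vec Coord j) {t⊆Kerπ : True (⊆Kerπ? t)} → u ≡1mod3 →
          ∀ {l l′} → Twisted z zero (unitVal u) l l′ → l ∈ t → l′ ∈ t → l ≡ l′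
  rigid t {t⊆Kerπ} s {l} (twisted-by k refl) l∈t _ = sym (twist-trivial z u k l s (⊆Kerπ t {t⊆Kerπ} l l∈t))

off-rigid : ∀ {n z u} {ls ls′ : Vec Coord n} → Pointwise (Twisted z zero (unitVal u)) ls ls′ →
            NormalOff ls → NormalOff ls′ → ls ≡ ls′
off-rigid {z = z} {u} = EchelonRigidity.echelon-rigid (Twisted z zero (unitVal u)) (z ≡ zero × u ≡ zero)
  (Kerπ-separated u (⊆Kerπ kerπ) (⊆¬Kerπ piv)) (Kerπ-separated⁻ u (⊆Kerπ kerπ) (⊆¬Kerπ piv))
  piv-stable rigid rigid rigid
  where
  piv : Vec Coord 1
  piv = (zero , # 1) ∷ []
  pivot-stable : ∀ z u k → twistᶜ z zero (unitVal u) k (zero , # 1) ≡ (zero , # 1) → z ≡ zero × u ≡ zero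
  pivot-stable = from-yes (all? λ z → all? λ u → ∀ᶜ? λ k →
    (twistᶜ z zero (unitVal u) k (zero , # 1) ≟ᶜ (zero , # 1)) →-dec (z ≟ zero ×-dec u ≟ zero))
  twist-identity : ∀ k l → twistᶜ zero zero 1 k l ≡ l
  twist-identity = from-yes (∀ᶜ? λ k → ∀ᶜ? λ l → twistᶜ zero zero 1 k l ≟ᶜ l)

  piv-stable : ∀ {l l′} → Twisted z zero (unitVal u) l l′ → l ∈ piv → l′ ∈ piv → z ≡ zero × u ≡ zero
  piv-stable (twisted-by k refl) (here refl) (here eq) = pivot-stable z u k eq
  rigid : ∀ {P : Coord → Set} → z ≡ zero × u ≡ zero →
          ∀ {l l′} → Twisted z zero (unitVal u) l l′ → P l → P l′ → l ≡ l′
  rigid (refl , refl) {l} (twisted-by k refl) _ _ = sym (twist-identity k l)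

x-rigid : ∀ {z u} → u ≡1mod3 → ∀ {n} {ls ls′ : Vec Coord n} → Pointwise (Twisted z (# 1) (unitVal u)) ls ls′ →
          NormalX ls → NormalX ls′ → ls ≡ ls′
x-rigid {z} {u} u≡1 = rigid
  where
  pre piv tl : Vec Coord _
  pre = axis multiplesOf3
  piv = axis (# 1 ∷ # 2 ∷ [])
  tl  = axis (allFin 9)

  pivot-stable : ∀ z u k l → u ≡1mod3 → l ∈ piv → twistᶜ z (# 1) (unitVal u) k l ∈ piv → u ≡ zero
  pivot-stable = from-yes (all? λ z → all? λ u → ∀ᶜ? λ k → ∀ᶜ? λ l →
    (u ≡1mod3?) →-dec (l ∈? piv) →-dec (twistᶜ z (# 1) (unitVal u) k l ∈? piv) →-dec (u ≟ zero))
  pre-fixed : ∀ z u k l → u ≡1mod3 → l ∈ pre → twistᶜ z (# 1) (unitVal u) k l ∈ pre →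
              twistᶜ z (# 1) (unitVal u) k l ≡ l
  pre-fixed = from-yes (all? λ z → all? λ u → ∀ᶜ? λ k → ∀ᶜ? λ l →
    (u ≡1mod3?) →-dec (l ∈? pre) →-dec (twistᶜ z (# 1) (unitVal u) k l ∈? pre) →-dec
    (twistᶜ z (# 1) (unitVal u) k l ≟ᶜ l))
  fixed? : ∀ {j} (t : Vec Coord j) → Dec (∀ z k l → l ∈ t → twistᶜ z (# 1) 1 k l ∈ t → twistᶜ z (# 1) 1 k l ≡ l)
  fixed? t = all? λ z → ∀ᶜ? λ k → ∀ᶜ? λ l →
    (l ∈? t) →-dec (twistᶜ z (# 1) 1 k l ∈? t) →-dec (twistᶜ z (# 1) 1 k l ≟ᶜ l)

  piv-stable : ∀ {l l′} → Twisted z (# 1) (unitVal u) l l′ → l ∈ piv → l′ ∈ piv → u ≡ zero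
  piv-stable {l} (twisted-by k refl) = pivot-stable z u k l u≡1
  pre-rigid : ∀ {l l′} → Twisted z (# 1) (unitVal u) l l′ → l ∈ pre → l′ ∈ pre → l ≡ l′
  pre-rigid {l} (twisted-by k refl) p p′ = sym (pre-fixed z u k l u≡1 p p′)
  rigid-in : ∀ {j} (t : Vec Coord j) {t-fixed : True (fixed? t)} → u ≡ zero →
             ∀ {l l′} → Twisted z (# 1) (unitVal u) l l′ → l ∈ t → l′ ∈ t → l ≡ l′
  rigid-in t {t-fixed} refl {l} (twisted-by k refl) p p′ = sym (toWitness t-fixed z k l p p′)

  open EchelonRigidity (Twisted z (# 1) (unitVal u)) (u ≡ zero)
    (Kerπ-separated u (⊆Kerπ pre) (⊆¬Kerπ piv)) (Kerπ-separated⁻ u (⊆Kerπ pre) (⊆¬Kerπ piv))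
    piv-stable (λ _ → pre-rigid) (rigid-in piv) (rigid-in tl)

  rigid : ∀ {n} {ls ls′ : Vec Coord n} → Pointwise (Twisted z (# 1) (unitVal u)) ls ls′ →
          NormalX ls → NormalX ls′ → ls ≡ ls′
  rigid rs (inj₁ pres) (inj₁ pres′) = All-rigid pre-rigid rs pres pres′
  rigid rs (inj₁ pres) (inj₂ ech′)  = ⊥-elim (All-pre-echelon-disjoint rs pres ech′)
  rigid rs (inj₂ ech)  (inj₁ pres′) = ⊥-elim (echelon-All-pre-disjoint rs ech pres′)
  rigid rs (inj₂ ech)  (inj₂ ech′)  = echelon-rigid rs ech ech′

×₃-zero : ∀ m → m ×₃ zero ≡ zero
×₃-zero zero    = refl
×₃-zero (suc m) = cong (zero +₃_) (×₃-zero m)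

unit-×₃-1 : ∀ u → unitVal u ×₃ # 1 ≢ zero
unit-×₃-1 = from-yes (all? λ u → ¬? (unitVal u ×₃ # 1 ≟ zero))

unit-×₃-1-fixed : ∀ u → # 1 ≡ unitVal u ×₃ # 1 → u ≡1mod3
unit-×₃-1-fixed = from-yes (all? λ u → (# 1 ≟ unitVal u ×₃ # 1) →-dec (u ≡1mod3?))

canonical-rigid : ∀ {n} {ρ ρ′ : G n} → Canonical ρ → Canonical ρ′ → ρ ⇝ ρ′ → ρ ≡ ρ′
canonical-rigid (ker p) (ker p′) (u , conj) =
  cong (glue zero) (ker-rigid {u = u} (proj₂ (conj-glue-Twisted (unitVal u) conj)) p p′)
canonical-rigid (ker p) (off p′) (u , conj) =
  ⊥-elim (normalOff-¬Kerπ p′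
    (Pointwise-All (Twisted-Kerπ u) (proj₂ (conj-glue-Twisted (unitVal u) conj)) (normalKer-Kerπ p)))
canonical-rigid (off p) (ker p′) (u , conj) =
  ⊥-elim (normalOff-¬Kerπ p
    (Pointwise-All⁻ (Twisted-Kerπ⁻ u) (proj₂ (conj-glue-Twisted (unitVal u) conj)) (normalKer-Kerπ p′)))
canonical-rigid (off p) (off p′) (u , conj) =
  cong (glue zero) (off-rigid {u = u} (proj₂ (conj-glue-Twisted (unitVal u) conj)) p p′)
canonical-rigid (x≡1 p) (x≡1 p′) (u , conj) =
  cong (glue (# 1))
       (x-rigid {u = u} (unit-×₃-1-fixed u (conj-glue-x (unitVal u) conj)) (proj₂ (conj-glue-Twisted (unitVal u) conj)) p p′)
canonical-rigid (ker _) (x≡1 _) (u , conj) = ⊥-elim (0≢1+n (sym (trans (conj-glue-x (unitVal u) conj) (×₃-zero (unitVal u)))))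
canonical-rigid (off _) (x≡1 _) (u , conj) = ⊥-elim (0≢1+n (sym (trans (conj-glue-x (unitVal u) conj) (×₃-zero (unitVal u)))))
canonical-rigid (x≡1 _) (ker _) (u , conj) = ⊥-elim (unit-×₃-1 u (sym (conj-glue-x (unitVal u) conj)))
canonical-rigid (x≡1 _) (off _) (u , conj) = ⊥-elim (unit-×₃-1 u (sym (conj-glue-x (unitVal u) conj)))

-- Existence of canonical representatives

Twisted? : ∀ z x m l l′ → Dec (Twisted z x m l l′)
Twisted? z x m l l′ =
  map′ (λ (k , eq) → twisted-by k eq) (λ (twisted-by k eq) → k , eq) (∃ᶜ? λ k → l′ ≟ᶜ twistᶜ z x m k l)

Inverse : Fin 6 → Fin 6 → Set
Inverse w u = (unitVal w * unitVal u) % 9 ≡ 1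

Inverse? : ∀ w u → Dec (Inverse w u)
Inverse? w u = (unitVal w * unitVal u) % 9 ≟ℕ 1

untwist : Fin 3 → Fin 6 → Coord → Coord
untwist z w = twistᶜ (-₃ z) zero (unitVal w) 𝟘

untwist-Twisted : ∀ z w u → Inverse w u → ∀ l → Twisted z zero (unitVal u) (untwist z w l) l
untwist-Twisted z w u w⁻¹≡u l = twisted-by 𝟘 (sym (untwist-inverse z w u w⁻¹≡u l))
  where
  untwist-inverse : ∀ z w u → Inverse w u → ∀ l → twistᶜ z zero (unitVal u) 𝟘 (untwist z w l) ≡ l
  untwist-inverse = from-yes (all? λ z → all? λ w → all? λ u → Inverse? w u →-dec ∀ᶜ? λ l →
    twistᶜ z zero (unitVal u) 𝟘 (untwist z w l) ≟ᶜ l)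

untwist-kerπ : ∀ z w l → Kerπ l → untwist z w l ∈ kerπ
untwist-kerπ = from-yes (all? λ z → all? λ w → ∀ᶜ? λ l → Kerπ? l →-dec (untwist z w l ∈? kerπ))

∈coords : ∀ l → l ∈ coords
∈coords = from-yes (∀ᶜ? λ l → l ∈? coords)

axial : Fin 6 → Coord → Coord
axial w (_ , v₁) = zero , (unitVal w * toℕ v₁) mod 9

axial-Twisted : ∀ w u → Inverse w u → ∀ l → Twisted zero (# 1) (unitVal u) (axial w l) l
axial-Twisted = from-yes (all? λ w → all? λ u → Inverse? w u →-dec ∀ᶜ? λ l → Twisted? zero (# 1) (unitVal u) (axial w l) l)

axial-Kerπ : ∀ w l → Kerπ l → axial w l ∈ axis multiplesOf3
axial-Kerπ = from-yes (all? λ w → ∀ᶜ? λ l → Kerπ? l →-dec (axial w l ∈? axis multiplesOf3))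

axial-axis : ∀ w l → axial w l ∈ axis (allFin 9)
axial-axis = from-yes (all? λ w → ∀ᶜ? λ l → axial w l ∈? axis (allFin 9))

-- Witnesses found by exhaustive search; opaque so that type checking never re-runs the search.
opaque
  normalise-ker : ∀ p → Kerπ p → p ≢ 𝟘 → Σ (Fin 6) λ w → Σ (Fin 6) λ u → Inverse w u × untwist zero w p ∈ signReps
  normalise-ker = from-yes (∀ᶜ? λ p → Kerπ? p →-dec ¬? (p ≟ᶜ 𝟘) →-dec
    any? λ w → any? λ u → Inverse? w u ×-dec (untwist zero w p ∈? signReps))

  normalise-off : ∀ p → ¬ Kerπ p →
                  Σ (Fin 3) λ z → Σ (Fin 6) λ w → Σ (Fin 6) λ u → Inverse w u × untwist z w p ≡ (zero , # 1)
  normalise-off = from-yes (∀ᶜ? λ p → ¬? (Kerπ? p) →-dec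
    any? λ z → any? λ w → any? λ u → Inverse? w u ×-dec (untwist z w p ≟ᶜ (zero , # 1)))

  normalise-x : ∀ x → x ≢ zero → Σ (Fin 6) λ w → Σ (Fin 6) λ u → Inverse w u × unitVal u ×₃ # 1 ≡ x
  normalise-x = from-yes (all? λ x → ¬? (x ≟ zero) →-dec
    any? λ w → any? λ u → Inverse? w u ×-dec (unitVal u ×₃ # 1 ≟ x))

  normalise-x-pivot : ∀ x p → x ≢ zero → ¬ Kerπ p →
                      Σ (Fin 6) λ w → Σ (Fin 6) λ u →
                      Inverse w u × unitVal u ×₃ # 1 ≡ x × axial w p ∈ axis (# 1 ∷ # 2 ∷ [])
  normalise-x-pivot = from-yes (all? λ x → ∀ᶜ? λ p → ¬? (x ≟ zero) →-dec ¬? (Kerπ? p) →-dec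
    any? λ w → any? λ u → Inverse? w u ×-dec (unitVal u ×₃ # 1 ≟ x) ×-dec (axial w p ∈? axis (# 1 ∷ # 2 ∷ [])))

Representative : ∀ {n} → G n → Set
Representative {n} g = Σ (G n) λ ρ → Canonical ρ × ρ ⇝ g

twisted-representative : ∀ {n z x} u (φ : Coord → Coord) → (∀ l → Twisted z x (unitVal u) (φ l) l) →
                         ∀ {x′} → unitVal u ×₃ x ≡ x′ → (ls : Vec Coord n) → Canonical (glue x (map φ ls)) →
                         Representative (glue x′ ls)
twisted-representative u φ twisted refl ls canonical =
  glue _ (map φ ls) , canonical , u , Twisted⇒conj-glue (Pointwise-map φ twisted ls)

module _ {n} {ls : Vec Coord n} where

  complete-ker : FirstFailure (_≡ 𝟘) ls → All Kerπ ls → Representative (glue zero ls)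
  complete-ker fw allKer =
    let w , u , w⁻¹≡u , normalised = normalise-ker (failure fw) (All-failure allKer fw) (failure-fails fw) in
    twisted-representative u (untwist zero w) (untwist-Twisted zero w u w⁻¹≡u) (×₃-zero (unitVal u)) ls
      (ker (echelon-map (untwist zero w) (λ { refl → here (twist-𝟘 (-₃ zero) w 𝟘) }) fw normalised
                        (All.map (λ {l} → untwist-kerπ zero w l) allKer)))

  complete-off : FirstFailure Kerπ ls → Representative (glue zero ls)
  complete-off fw =
    let z , w , u , w⁻¹≡u , normalised = normalise-off (failure fw) (failure-fails fw) in
    twisted-representative u (untwist z w) (untwist-Twisted z w u w⁻¹≡u) (×₃-zero (unitVal u)) ls
      (off (echelon-map (untwist z w) (λ {l} → untwist-kerπ z w l) fw (here normalised)
                        (All.universal (∈coords ∘ untwist z w) ls)))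

  complete-x-ker : ∀ {x} → x ≢ zero → All Kerπ ls → Representative (glue x ls)
  complete-x-ker x≢0 allKer =
    let w , u , w⁻¹≡u , u×1≡x = normalise-x _ x≢0 in
    twisted-representative u (axial w) (axial-Twisted w u w⁻¹≡u) u×1≡x ls
      (x≡1 (inj₁ (map⁺ (All.map (λ {l} → axial-Kerπ w l) allKer))))

  complete-x-off : ∀ {x} → x ≢ zero → FirstFailure Kerπ ls → Representative (glue x ls)
  complete-x-off x≢0 fw =
    let w , u , w⁻¹≡u , u×1≡x , normalised = normalise-x-pivot _ (failure fw) x≢0 (failure-fails fw) in
    twisted-representative u (axial w) (axial-Twisted w u w⁻¹≡u) u×1≡x ls
      (x≡1 (inj₂ (echelon-map (axial w) (λ {l} → axial-Kerπ w l) fw normalised (All.universal (axial-axis w) ls))))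

complete : ∀ {n} (g : G n) → g ≢ e → Representative g
complete = glue-elim (λ g → g ≢ e → Representative g) complete-glue
  where
  complete-glue : ∀ {n} x (ls : Vec Coord n) → glue x ls ≢ e → Representative (glue x ls)
  complete-glue zero ls g≢e =
    [ (λ allKer → [ (λ ls≡𝟘 → ⊥-elim (g≢e (≡e-glue refl ls≡𝟘))) , (λ fw → complete-ker fw allKer) ]′
                    (All-or-FirstFailure (_≟ᶜ 𝟘) ls))
    , complete-off
    ]′ (All-or-FirstFailure Kerπ? ls)
  complete-glue (suc x) ls _ =
    [ complete-x-ker {x = suc x} (λ ()) , complete-x-off {x = suc x} (λ ()) ]′ (All-or-FirstFailure Kerπ? ls)

-- Counting

*-^ : ∀ p q n → (p * q) ^ n ≡ p ^ n * q ^ n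
*-^ p q zero    = refl
*-^ p q (suc n) = trans (cong (p * q *_) (*-^ p q n)) (interchange p q (p ^ n) (q ^ n))
  where
  interchange : ∀ p q x y → p * q * (x * y) ≡ p * x * (q * y)
  interchange = solve-∀

exact-quotient : ∀ m r d q .{{_ : NonZero d}} → q * d + r ≡ m → (m ∸ r) / d ≡ q
exact-quotient m r d q eq = trans (cong (λ x → (x ∸ r) / d) (sym eq)) (trans (cong (_/ d) (m+n∸n≡m (q * d) r)) (m*n/n≡m q d))

cancel : ∀ x y d r .{{_ : NonZero d}} → x * d + r ≡ y * d + r → x ≡ y
cancel x y d r eq = *-cancelʳ-≡ x y d (+-cancelʳ-≡ r (x * d) (y * d) eq)

-- (3ⁿ ∸ 1) / 2 and (9ⁿ ∸ 3ⁿ) / 6, as echelon counts so that their closed forms come for free.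
halfCount sixthCount : ℕ → ℕ
halfCount  = echelonCount 1 1 3
sixthCount = echelonCount 3 1 9

halfCount-closed : ∀ n → halfCount n * 2 + 1 ≡ 3 ^ n
halfCount-closed n = begin
  halfCount n * 2 + 1          ≡⟨ cong (λ x → halfCount n * 2 + x) (sym (trans (*-identityˡ (1 ^ n)) (^-zeroˡ n))) ⟩
  halfCount n * 2 + 1 * 1 ^ n  ≡⟨ echelonCount-closed 1 2 1 n ⟩
  1 * 3 ^ n                    ≡⟨ *-identityˡ (3 ^ n) ⟩
  3 ^ n                        ∎
  where open ≡-Reasoning

sixthCount-closed : ∀ n → sixthCount n * 6 + 3 ^ n ≡ 3 ^ n * 3 ^ n
sixthCount-closed n = begin
  sixthCount n * 6 + 3 ^ n      ≡⟨ cong (λ x → sixthCount n * 6 + x) (sym (*-identityˡ (3 ^ n))) ⟩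
  sixthCount n * 6 + 1 * 3 ^ n  ≡⟨ echelonCount-closed 3 6 1 n ⟩
  1 * 9 ^ n                     ≡⟨ trans (*-identityˡ (9 ^ n)) (*-^ 3 3 n) ⟩
  3 ^ n * 3 ^ n                 ∎
  where open ≡-Reasoning

countKer≡ : ∀ n → countKer n ≡ halfCount n + 3 ^ n * halfCount n
countKer≡ n = cancel _ _ 8 4 (begin
  countKer n * 8 + 4                       ≡⟨ cong (λ x → countKer n * 8 + 4 * x) (^-zeroˡ n) ⟨
  countKer n * 8 + 4 * 1 ^ n               ≡⟨ echelonCount-closed 1 8 4 n ⟩
  4 * 9 ^ n                                ≡⟨ cong (4 *_) (*-^ 3 3 n) ⟩
  4 * (3 ^ n * 3 ^ n)                      ≡⟨ subst (λ t → 4 * (t * t) ≡ (h + t * h) * 8 + 4) (halfCount-closed n) (square h) ⟩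
  (h + 3 ^ n * h) * 8 + 4                  ∎)
  where
  open ≡-Reasoning
  h = halfCount n
  square : ∀ h → 4 * ((h * 2 + 1) * (h * 2 + 1)) ≡ (h + (h * 2 + 1) * h) * 8 + 4
  square = solve-∀

countOff≡ : ∀ m → countOff (suc m) ≡ 3 ^ m * sixthCount (suc m)
countOff≡ m = cancel _ _ 18 (t * t) (begin
  countOff (suc m) * 18 + t * t          ≡⟨ cong (λ x → countOff (suc m) * 18 + x) (trans (*-identityˡ _) (*-^ 3 3 (suc m))) ⟨
  countOff (suc m) * 18 + 1 * 9 ^ suc m  ≡⟨ echelonCount-closed 9 18 1 (suc m) ⟩
  1 * 27 ^ suc m                         ≡⟨ trans (*-identityˡ _) (trans (*-^ 3 9 (suc m)) (cong (t *_) (*-^ 3 3 (suc m)))) ⟩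
  t * (t * t)                            ≡⟨ cong (t *_) (sixthCount-closed (suc m)) ⟨
  t * (k * 6 + t)                        ≡⟨ distrib (3 ^ m) k ⟨
  3 ^ m * k * 18 + t * t                 ∎)
  where
  open ≡-Reasoning
  t = 3 ^ suc m
  k = sixthCount (suc m)
  distrib : ∀ s k → s * k * 18 + 3 * s * (3 * s) ≡ 3 * s * (k * 6 + 3 * s)
  distrib = solve-∀

countX≡ : ∀ n → countX n ≡ 3 ^ n + 2 * sixthCount n
countX≡ n = cong (λ x → 3 ^ n + x) (cancel _ _ 6 (2 * 3 ^ n) (begin
  echelonCount 3 2 9 n * 6 + 2 * 3 ^ n  ≡⟨ echelonCount-closed 3 6 2 n ⟩
  2 * 9 ^ n                             ≡⟨ cong (2 *_) (trans (*-^ 3 3 n) (sym (sixthCount-closed n))) ⟩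
  2 * (sixthCount n * 6 + 3 ^ n)        ≡⟨ distrib (sixthCount n) (3 ^ n) ⟩
  2 * sixthCount n * 6 + 2 * 3 ^ n      ∎))
  where
  open ≡-Reasoning
  distrib : ∀ k t → 2 * (k * 6 + t) ≡ 2 * k * 6 + 2 * t
  distrib = solve-∀

count≡rhs : ∀ m → countKer (suc m) + (countOff (suc m) + countX (suc m)) ≡ rhs (suc m)
count≡rhs m = sym (begin
  rhs n                                ≡⟨ cong₂ (λ x y → x + 2 * y + t + t * x + (t * y) / 3) half sixth ⟩
  h + 2 * k + t + t * h + (t * k) / 3  ≡⟨ cong (λ x → h + 2 * k + t + t * h + x) third ⟩
  h + 2 * k + t + t * h + s * k        ≡⟨ regroup h k t (s * k) ⟩
  (h + t * h) + (s * k + (t + 2 * k))  ≡⟨ cong₂ (λ x y → x + (y + (t + 2 * k))) (countKer≡ n) (countOff≡ m) ⟨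
  countKer n + (countOff n + (t + 2 * k)) ≡⟨ cong (λ x → countKer n + (countOff n + x)) (countX≡ n) ⟨
  countKer n + (countOff n + countX n) ∎)
  where
  open ≡-Reasoning
  n = suc m
  s = 3 ^ m
  t = 3 ^ n
  h = halfCount n
  k = sixthCount n
  half : (t ∸ 1) / 2 ≡ h
  half = exact-quotient t 1 2 h (halfCount-closed n)
  sixth : (9 ^ n ∸ t) / 6 ≡ k
  sixth = exact-quotient (9 ^ n) t 6 k (trans (sixthCount-closed n) (sym (*-^ 3 3 n)))
  third : (t * k) / 3 ≡ s * k
  third = trans (cong (_/ 3) (comm s k)) (m*n/n≡m (s * k) 3)
    where
    comm : ∀ s k → 3 * s * k ≡ s * k * 3
    comm = solve-∀
  regroup : ∀ h k t x → h + 2 * k + t + t * h + x ≡ (h + t * h) + (x + (t + 2 * k))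
  regroup = solve-∀

numClasses : ∀ {n N} → Enumeration (Canonical {n}) N → NumClasses n N
numClasses {n} {N} E = elem E , (λ i → canonical-≢e (elem-sat E i)) , injective , surjective
  where
  injective : ∀ i j → elem E i ∼ elem E j → i ≡ j
  injective i j i∼j = elem-injective E (canonical-rigid (elem-sat E i) (elem-sat E j) (∼⇒⇝ (canonical-≢e (elem-sat E i)) i∼j))
  surjective : ∀ g → g ≢ e → Σ (Fin N) λ i → elem E i ∼ g
  surjective g g≢e =
    let ρ , canonical , ρ⇝g = complete g g≢e ; i , elem≡ρ = index-of E ρ canonical in
    i , subst (_∼ g) (sym elem≡ρ) (⇝⇒∼ (canonical-≢e canonical) ρ⇝g)

theorem4p2 : ∀ (n : ℕ) → 1 ≤ n → NumClasses n (rhs n)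
theorem4p2 (suc m) _ = subst (NumClasses (suc m)) (count≡rhs m) (numClasses (canonical-enumeration (suc m)))
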